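{- The axiom system $\mathcal{E}_v$ is ground complete for verdict equivalence over $Mon_F$: for all closed monitors $m,n\in Mon_F$, if $m\simeq n$ then $\mathcal{E}_v\vdash m=n$.
   Context: Fix a set $Act$ of visible actions, a symbol $\tau\notin Act$, and a countably infinite set $Var$ of variables disjoint from $Act\cup\{\tau\}$. The set $Mon_F$ of (regular, recursion-free) monitors is generated by the grammar $m,n ::= v \mid a.m \mid m+n \mid x$ with $a\in Act$, $x\in Var$, and verdicts $v ::= \mathit{end}\mid \mathit{yes}\mid \mathit{no}$. A monitor is closed if it contains no variables; a (closed) substitution $\sigma$ maps variables to (closed) monitors and $\sigma(m)$ denotes its application to $m$. Transitions: for $\alpha\in Act\cup\{\tau\}$, $\xrightarrow{\alpha}$ is the least relation with $a.m\xrightarrow{a}m$; if $m\xrightarrow{\alpha}m'$ then $m+n\xrightarrow{\alpha}m'$ and $n+m\xrightarrow{\alpha}m'$; and $v\xrightarrow{\alpha}v$ for every verdict $v$ and every $\alpha$ (variables have no transitions). Weak transitions: $m\xRightarrow{\varepsilon}m'$ iff $m(\xrightarrow{\tau})^*m'$; $m\xRightarrow{a}m'$ iff $m\xRightarrow{\varepsilon}m_1\xrightarrow{a}m_2\xRightarrow{\varepsilon}m'$ for some $m_1,m_2$; $m\xRightarrow{as'}m'$ ($s'\neq\varepsilon$) iff $m\xRightarrow{a}m_1\xRightarrow{s'}m'$ for some $m_1$. Let $L_a(m)=\{s\in Act^*\mid m\xRightarrow{s}\mathit{yes}\}$ and $L_r(m)=\{s\in Act^*\mid m\xRightarrow{s}\mathit{no}\}$.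 For closed $m,n$: $m\simeq n$ (verdict equivalence) iff $L_a(m)=L_a(n)$ and $L_r(m)=L_r(n)$. For a set $\mathcal{E}$ of equations between monitors, $\mathcal{E}\vdash m=n$ means $m=n$ is derivable from $\mathcal{E}$ by the rules of equational logic: reflexivity, symmetry, transitivity, substitutivity (from $t=t'$ infer $\sigma(t)=\sigma(t')$ for any substitution $\sigma$), and congruence with respect to $a.\_$ (each $a\in Act$) and $+$. $\mathcal{E}_v$ consists of: (A1) $x+y=y+x$; (A2) $x+(y+z)=(x+y)+z$; (A3) $x+x=x$; (A4) $x+\mathit{end}=x$; and for each $a\in Act$: $(E_a)$ $a.\mathit{end}=\mathit{end}$; $(Y_a)$ $\mathit{yes}=\mathit{yes}+a.\mathit{yes}$; $(N_a)$ $\mathit{no}=\mathit{no}+a.\mathit{no}$; $(D_a)$ $a.(x+y)=a.x+a.y$. -}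

module Defs where

open import Data.Nat using (ℕ)
open import Data.List using (List; []; _∷_)
open import Data.Product using (_×_; _,_)
open import Function.Bundles using (_⇔_)

Var : Set
Var = ℕ

module Monitors (Act : Set) where

  data Verdict : Set where
    end yes no : Verdict

  data Mon : Set where
    verd : Verdict → Mon
    _·_  : Act → Mon → Mon
    _⊕_  : Mon → Mon → Mon
    var  : Var → Mon

  infixr 7 _·_
  infixl 6 _⊕_

  data Closed : Mon → Set where
    c-verd : ∀ v → Closed (verd v)
    c-pre  : ∀ a {m} → Closed m → Closed (a · m)
    c-sum  : ∀ {m n} → Closed m → Closed n → Closed (m ⊕ n)

  Subst : Set
  Subst = Var → Mon

  subst : Subst → Mon → Mon
  subst σ (verd v) = verd v
  subst σ (a · m)  = a · subst σ m
  subst σ (m ⊕ n)  = subst σ m ⊕ subst σ n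
  subst σ (var x)  = σ x

  data Label : Set where
    act : Act → Label
    τ   : Label

  data _─[_]→_ : Mon → Label → Mon → Set where
    pre  : ∀ {a m} → (a · m) ─[ act a ]→ m
    sumL : ∀ {m n α m'} → m ─[ α ]→ m' → (m ⊕ n) ─[ α ]→ m'
    sumR : ∀ {m n α m'} → m ─[ α ]→ m' → (n ⊕ m) ─[ α ]→ m'
    verdict : ∀ {v α} → verd v ─[ α ]→ verd v

  data _⇒ε_ : Mon → Mon → Set where
    ε-refl : ∀ {m} → m ⇒ε m
    ε-step : ∀ {m m₁ m'} → m ─[ τ ]→ m₁ → m₁ ⇒ε m' → m ⇒ε m'

  data _⇒[_]_ : Mon → Act → Mon → Set where
    weak : ∀ {m m₁ m₂ m' a} → m ⇒ε m₁ → m₁ ─[ act a ]→ m₂ → m₂ ⇒ε m' → m ⇒[ a ] m'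

  data _⇒*[_]_ : Mon → List Act → Mon → Set where
    tr-ε  : ∀ {m m'} → m ⇒ε m' → m ⇒*[ [] ] m'
    tr-a  : ∀ {m a m'} → m ⇒[ a ] m' → m ⇒*[ a ∷ [] ] m'
    tr-as : ∀ {m a b s m₁ m'} → m ⇒[ a ] m₁ → m₁ ⇒*[ b ∷ s ] m' → m ⇒*[ a ∷ b ∷ s ] m'

  Lₐ : Mon → List Act → Set
  Lₐ m s = m ⇒*[ s ] verd yes

  Lᵣ : Mon → List Act → Set
  Lᵣ m s = m ⇒*[ s ] verd no

  _≃_ : Mon → Mon → Set
  m ≃ n = (∀ s → Lₐ m s ⇔ Lₐ n s) × (∀ s → Lᵣ m s ⇔ Lᵣ n s)

  x y z : Mon
  x = var 0
  y = var 1
  z = var 2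

  data Ev : Mon → Mon → Set where
    A1 : Ev (x ⊕ y) (y ⊕ x)
    A2 : Ev (x ⊕ (y ⊕ z)) ((x ⊕ y) ⊕ z)
    A3 : Ev (x ⊕ x) x
    A4 : Ev (x ⊕ verd end) x
    Eₐ : ∀ a → Ev (a · verd end) (verd end)
    Yₐ : ∀ a → Ev (verd yes) (verd yes ⊕ a · verd yes)
    Nₐ : ∀ a → Ev (verd no) (verd no ⊕ a · verd no)
    Dₐ : ∀ a → Ev (a · (x ⊕ y)) (a · x ⊕ a · y)

  data _⊢_≈_ (ℰ : Mon → Mon → Set) : Mon → Mon → Set where
    ax    : ∀ {t t'} → ℰ t t' → ℰ ⊢ t ≈ t'
    refl  : ∀ {t} → ℰ ⊢ t ≈ t
    sym   : ∀ {t t'} → ℰ ⊢ t ≈ t' → ℰ ⊢ t' ≈ t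
    trans : ∀ {t t' t''} → ℰ ⊢ t ≈ t' → ℰ ⊢ t' ≈ t'' → ℰ ⊢ t ≈ t''
    inst  : ∀ {t t'} (σ : Subst) → ℰ ⊢ t ≈ t' → ℰ ⊢ subst σ t ≈ subst σ t'
    cong· : ∀ a {t t'} → ℰ ⊢ t ≈ t' → ℰ ⊢ (a · t) ≈ (a · t')
    cong⊕ : ∀ {t₁ t₁' t₂ t₂'} → ℰ ⊢ t₁ ≈ t₁' → ℰ ⊢ t₂ ≈ t₂' → ℰ ⊢ (t₁ ⊕ t₂) ≈ (t₁' ⊕ t₂')

-- Write m ⊒ n for ℰᵥ ⊢ m = m ⊕ n: by A1–A3 this is a preorder, antisymmetric up
-- to ℰᵥ, and by Dₐ it is monotone under prefixing. Every weak trace m ⇒ˢ m'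
-- gives m ⊒ s.m': τ-moves are verdict self-loops, and the visible self-loops
-- v ─a→ v are absorbed by Eₐ, Yₐ, Nₐ. Conversely a closed n is built from
-- verdicts by prefixing and sums, so by induction on n (accumulating the prefix
-- w) m ⊒ w.n holds as soon as every verdict reachable from n after s is
-- reachable from m after w s. Equal languages thus give m ⊒ n ⊒ m.
module Submission where

open import Defs
open import Data.List using (List; []; _∷_; _++_)
open import Data.List.Properties using (++-identityʳ; ++-assoc)
open import Data.Product using (_×_; _,_)
open import Function using (_∘_)
open import Function.Bundles using (Equivalence)
open import Relation.Binary.PropositionalEquality as ≡ using (_≡_)

module VerdictEquivalence (Act : Set) where
  open Monitors Act

  infix 4 _≋_ _⊒_
  infixr 7 _·*_

  _≋_ : Mon → Mon → Set
  p ≋ q = Ev ⊢ p ≈ q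

  [_,_,_] : Mon → Mon → Mon → Subst
  [ p , q , r ] 0 = p
  [ p , q , r ] 1 = q
  [ p , q , r ] _ = r

  ⊕-comm : ∀ p q → p ⊕ q ≋ q ⊕ p
  ⊕-comm p q = inst [ p , q , q ] (ax A1)

  ⊕-assoc : ∀ p q r → p ⊕ (q ⊕ r) ≋ (p ⊕ q) ⊕ r
  ⊕-assoc p q r = inst [ p , q , r ] (ax A2)

  ⊕-idem : ∀ p → p ⊕ p ≋ p
  ⊕-idem p = inst [ p , p , p ] (ax A3)

  ⊕-identityʳ : ∀ p → p ⊕ verd end ≋ p
  ⊕-identityʳ p = inst [ p , p , p ] (ax A4)

  ·-distrib-⊕ : ∀ a p q → a · (p ⊕ q) ≋ a · p ⊕ a · q
  ·-distrib-⊕ a p q = inst [ p , q , q ] (ax (Dₐ a))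

  _⊒_ : Mon → Mon → Set
  m ⊒ n = m ≋ m ⊕ n

  ⊒-refl : ∀ m → m ⊒ m
  ⊒-refl m = sym (⊕-idem m)

  ⊒-trans : ∀ {m n k} → m ⊒ n → n ⊒ k → m ⊒ k
  ⊒-trans {m} {n} {k} m⊒n n⊒k =
    trans m⊒n (trans (cong⊕ refl n⊒k) (trans (⊕-assoc m n k) (cong⊕ (sym m⊒n) refl)))

  ⊒-antisym : ∀ {m n} → m ⊒ n → n ⊒ m → m ≋ n
  ⊒-antisym {m} {n} m⊒n n⊒m = trans m⊒n (trans (⊕-comm m n) (sym n⊒m))

  ⊒-respʳ-≋ : ∀ {m n n'} → n ≋ n' → m ⊒ n' → m ⊒ n
  ⊒-respʳ-≋ n≋n' m⊒n' = trans m⊒n' (cong⊕ refl (sym n≋n'))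

  ⊒-⊕ : ∀ {m n₁ n₂} → m ⊒ n₁ → m ⊒ n₂ → m ⊒ n₁ ⊕ n₂
  ⊒-⊕ {m} {n₁} {n₂} m⊒n₁ m⊒n₂ =
    trans m⊒n₁ (trans (cong⊕ m⊒n₂ refl)
      (trans (sym (⊕-assoc m n₂ n₁)) (cong⊕ refl (⊕-comm n₂ n₁))))

  ⊕-⊒ˡ : ∀ m₁ m₂ → m₁ ⊕ m₂ ⊒ m₁
  ⊕-⊒ˡ m₁ m₂ =
    trans (cong⊕ (sym (⊕-idem m₁)) refl) (trans (sym (⊕-assoc m₁ m₁ m₂))
      (trans (cong⊕ refl (⊕-comm m₁ m₂)) (⊕-assoc m₁ m₂ m₁)))

  ⊕-⊒ʳ : ∀ m₁ m₂ → m₁ ⊕ m₂ ⊒ m₂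
  ⊕-⊒ʳ m₁ m₂ = trans (cong⊕ refl (sym (⊕-idem m₂))) (⊕-assoc m₁ m₂ m₂)

  ·-mono-⊒ : ∀ a {m n} → m ⊒ n → a · m ⊒ a · n
  ·-mono-⊒ a {m} {n} m⊒n = trans (cong· a m⊒n) (·-distrib-⊕ a m n)

  ⊒-end : ∀ m → m ⊒ verd end
  ⊒-end m = sym (⊕-identityʳ m)

  verd-⊒-· : ∀ a v → verd v ⊒ a · verd v
  verd-⊒-· a end = ⊒-respʳ-≋ (ax (Eₐ a)) (⊒-end _)
  verd-⊒-· a yes = ax (Yₐ a)
  verd-⊒-· a no  = ax (Nₐ a)

  _·*_ : List Act → Mon → Mon
  []      ·* n = n
  (a ∷ w) ·* n = a · (w ·* n)

  ·*-++ : ∀ w u n → (w ++ u) ·* n ≡ w ·* (u ·* n)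
  ·*-++ []      u n = ≡.refl
  ·*-++ (a ∷ w) u n = ≡.cong (a ·_) (·*-++ w u n)

  ·*-end : ∀ w → w ·* verd end ≋ verd end
  ·*-end []      = refl
  ·*-end (a ∷ w) = trans (cong· a (·*-end w)) (ax (Eₐ a))

  ·*-distrib-⊕ : ∀ w n₁ n₂ → w ·* (n₁ ⊕ n₂) ≋ w ·* n₁ ⊕ w ·* n₂
  ·*-distrib-⊕ []      n₁ n₂ = refl
  ·*-distrib-⊕ (a ∷ w) n₁ n₂ = trans (cong· a (·*-distrib-⊕ w n₁ n₂)) (·-distrib-⊕ a _ _)

  visible-step⇒⊒ : ∀ {m a m'} → m ─[ act a ]→ m' → m ⊒ a · m'
  visible-step⇒⊒ pre            = ⊒-refl _
  visible-step⇒⊒ (sumL t)       = ⊒-trans (⊕-⊒ˡ _ _) (visible-step⇒⊒ t)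
  visible-step⇒⊒ (sumR t)       = ⊒-trans (⊕-⊒ʳ _ _) (visible-step⇒⊒ t)
  visible-step⇒⊒ {a = a} verdict = verd-⊒-· a _

  τ-step⇒⊒ : ∀ {m m'} → m ─[ τ ]→ m' → m ⊒ m'
  τ-step⇒⊒ (sumL t) = ⊒-trans (⊕-⊒ˡ _ _) (τ-step⇒⊒ t)
  τ-step⇒⊒ (sumR t) = ⊒-trans (⊕-⊒ʳ _ _) (τ-step⇒⊒ t)
  τ-step⇒⊒ verdict  = ⊒-refl _

  ⇒ε⇒⊒ : ∀ {m m'} → m ⇒ε m' → m ⊒ m'
  ⇒ε⇒⊒ ε-refl       = ⊒-refl _
  ⇒ε⇒⊒ (ε-step t r) = ⊒-trans (τ-step⇒⊒ t) (⇒ε⇒⊒ r)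

  weak-step⇒⊒ : ∀ {m a m'} → m ⇒[ a ] m' → m ⊒ a · m'
  weak-step⇒⊒ {a = a} (weak r t r') =
    ⊒-trans (⇒ε⇒⊒ r) (⊒-trans (visible-step⇒⊒ t) (·-mono-⊒ a (⇒ε⇒⊒ r')))

  trace⇒⊒ : ∀ {m w m'} → m ⇒*[ w ] m' → m ⊒ w ·* m'
  trace⇒⊒ (tr-ε r)           = ⇒ε⇒⊒ r
  trace⇒⊒ (tr-a t)           = weak-step⇒⊒ t
  trace⇒⊒ {w = a ∷ _} (tr-as t r) = ⊒-trans (weak-step⇒⊒ t) (·-mono-⊒ a (trace⇒⊒ r))

  ·-trace : ∀ {n s n' a} → n ⇒*[ s ] n' → (a · n) ⇒*[ a ∷ s ] n'
  ·-trace (tr-ε r)    = tr-a (weak ε-refl pre r)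
  ·-trace (tr-a t)    = tr-as (weak ε-refl pre ε-refl) (tr-a t)
  ·-trace (tr-as t r) = tr-as (weak ε-refl pre ε-refl) (tr-as t r)

  _StepsInto_ : Mon → Mon → Set
  n StepsInto n' = ∀ {α m'} → n ─[ α ]→ m' → n' ─[ α ]→ m'

  module _ {n n' : Mon} (steps : n StepsInto n') where

    -- A verdict target matters for the empty ε-path: n = verd v then loops
    -- to itself by τ, so n' reaches verd v in one τ-step.
    StepsInto-⇒ε-verd : ∀ {v} → n ⇒ε verd v → n' ⇒ε verd v
    StepsInto-⇒ε-verd ε-refl       = ε-step (steps verdict) ε-refl
    StepsInto-⇒ε-verd (ε-step t r) = ε-step (steps t) r

    StepsInto-⇒ : ∀ {a m} → n ⇒[ a ] m → n' ⇒[ a ] m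
    StepsInto-⇒ (weak ε-refl t r)       = weak ε-refl (steps t) r
    StepsInto-⇒ (weak (ε-step t r) u r') = weak (ε-step (steps t) r) u r'

    StepsInto-trace-verd : ∀ {s v} → n ⇒*[ s ] verd v → n' ⇒*[ s ] verd v
    StepsInto-trace-verd (tr-ε r)    = tr-ε (StepsInto-⇒ε-verd r)
    StepsInto-trace-verd (tr-a t)    = tr-a (StepsInto-⇒ t)
    StepsInto-trace-verd (tr-as t r) = tr-as (StepsInto-⇒ t) r

  _⊆L[_]_ : Mon → List Act → Mon → Set
  n ⊆L[ w ] m = (∀ s → Lₐ n s → Lₐ m (w ++ s)) × (∀ s → Lᵣ n s → Lᵣ m (w ++ s))

  ⊆L-⊕ˡ : ∀ {n₁ n₂ w m} → (n₁ ⊕ n₂) ⊆L[ w ] m → n₁ ⊆L[ w ] m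
  ⊆L-⊕ˡ (acc , rej) = (λ s → acc s ∘ StepsInto-trace-verd sumL)
                    , (λ s → rej s ∘ StepsInto-trace-verd sumL)

  ⊆L-⊕ʳ : ∀ {n₁ n₂ w m} → (n₁ ⊕ n₂) ⊆L[ w ] m → n₂ ⊆L[ w ] m
  ⊆L-⊕ʳ (acc , rej) = (λ s → acc s ∘ StepsInto-trace-verd sumR)
                    , (λ s → rej s ∘ StepsInto-trace-verd sumR)

  ⊆L-· : ∀ {a n w m} → (a · n) ⊆L[ w ] m → n ⊆L[ w ++ a ∷ [] ] m
  ⊆L-· {a} {w = w} {m} (acc , rej) =
      (λ s l → ≡.subst (Lₐ m) (≡.sym (++-assoc w (a ∷ []) s)) (acc (a ∷ s) (·-trace l)))
    , (λ s l → ≡.subst (Lᵣ m) (≡.sym (++-assoc w (a ∷ []) s)) (rej (a ∷ s) (·-trace l)))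

  verdict-reached⇒⊒ : ∀ {m w v} → m ⇒*[ w ++ [] ] verd v → m ⊒ w ·* verd v
  verdict-reached⇒⊒ {m} {w} {v} r =
    trace⇒⊒ (≡.subst (λ u → m ⇒*[ u ] verd v) (++-identityʳ w) r)

  ⊆L⇒⊒ : ∀ {n} → Closed n → ∀ {w m} → n ⊆L[ w ] m → m ⊒ w ·* n
  ⊆L⇒⊒ (c-verd end) {w} {m} _ = ⊒-respʳ-≋ (·*-end w) (⊒-end m)
  ⊆L⇒⊒ (c-verd yes) (acc , _) = verdict-reached⇒⊒ (acc [] (tr-ε ε-refl))
  ⊆L⇒⊒ (c-verd no)  (_ , rej) = verdict-reached⇒⊒ (rej [] (tr-ε ε-refl))
  ⊆L⇒⊒ (c-pre a {n} c) {w} {m} incl =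
    ≡.subst (m ⊒_) (·*-++ w (a ∷ []) n) (⊆L⇒⊒ c (⊆L-· incl))
  ⊆L⇒⊒ (c-sum c₁ c₂) {w} incl =
    ⊒-respʳ-≋ (·*-distrib-⊕ w _ _) (⊒-⊕ (⊆L⇒⊒ c₁ (⊆L-⊕ˡ incl)) (⊆L⇒⊒ c₂ (⊆L-⊕ʳ incl)))

theorem2 : (Act : Set) → let open Monitors Act in
    (m n : Mon) → Closed m → Closed n → m ≃ n → Ev ⊢ m ≈ n
theorem2 Act m n closed-m closed-n (same-accept , same-reject) =
  ⊒-antisym (⊆L⇒⊒ closed-n (Equivalence.from ∘ same-accept , Equivalence.from ∘ same-reject))
            (⊆L⇒⊒ closed-m (Equivalence.to ∘ same-accept , Equivalence.to ∘ same-reject))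
  where open VerdictEquivalence Act
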